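{- Let $p>2$ be a prime, let $n\ge 0$ be an integer, and let $\alpha,\beta\in\mathbb{Q}_p$ be such that their Browkin continued fraction expansions both have at least $n+1$ partial quotients and the $n$-th convergents coincide: $Q_n^\alpha=Q_n^\beta$. Then $|\alpha-\beta|_p<\frac{1}{p^{2n}}$.
   Context: Let $\mathcal{Y}=\mathbb{Z}[1/p]\cap(-p/2,p/2)$. For $\gamma\in\mathbb{Q}_p$, $s(\gamma)$ denotes the unique element of $\mathcal{Y}$ with $|\gamma-s(\gamma)|_p<1$. The Browkin continued fraction (BCF) expansion of $\gamma$ is obtained by $\gamma_0=\gamma$, $a_j=s(\gamma_j)$, $\gamma_{j+1}=1/(\gamma_j-a_j)$ as long as $\gamma_j\neq a_j$; the $a_j$ are the partial quotients. The convergents are $Q_j=A_j/B_j$, where $A_{ -1}=1$, $A_0=a_0$, $B_{ -1}=0$, $B_0=1$, $A_j=a_jA_{j-1}+A_{j-2}$, $B_j=a_jB_{j-1}+B_{j-2}$ for $j\ge1$; thus $Q_j=[a_0,\dots,a_j]$. $Q_n^\alpha,Q_n^\beta$ denote the $n$-th convergents of $\alpha,\beta$. -}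

module Defs where

open import Level using (Level; _⊔_) renaming (suc to lsuc)
open import Data.Nat as ℕ using (ℕ; zero; suc; _≤_; _<_; _^_)
open import Data.Nat.Primality using (Prime; prime⇒nonZero)
open import Data.Nat.Properties using (m^n≢0)
open import Data.Nat.Coprimality using (Coprime)
open import Data.Integer as ℤ using (ℤ; +_)
open import Data.Rational as ℚ using (ℚ; 0ℚ; 1ℚ; ↧ₙ_; ≢-nonZero; _÷_)
open import Data.Product using (Σ; ∃; _×_; _,_)
open import Relation.Nullary using (¬_; yes; no)
open import Relation.Binary.PropositionalEquality using (_≡_)
open import Algebra.Bundles using (CommutativeRing)

invp : (p : ℕ) → Prime p → ℚ
invp p pr = (+ 1) ℚ./ p
  where instance _ = prime⇒nonZero pr

invp2n : (p : ℕ) → Prime p → ℕ → ℚ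
invp2n p pr n = (+ 1) ℚ./ (p ^ (2 ℕ.* n))
  where
    instance _ = prime⇒nonZero pr
    instance _ = m^n≢0 p (2 ℕ.* n)

-- A model of the field ℚ_p: a field K with an absolute value ∣_∣ : K → ℚ,
-- a ring embedding ι : ℚ → K restricting to the p-adic absolute value on ℚ,
-- ℚ dense in K and K complete.  Such a K is (unique up to isometric
-- isomorphism) the field ℚ_p of p-adic numbers.
record Qp (p : ℕ) (pr : Prime p) (c ℓ : Level) : Set (lsuc (c ⊔ ℓ)) where
  field
    cring : CommutativeRing c ℓ
  open CommutativeRing cring public
  field
    nontrivial : ¬ (1# ≈ 0#)
    inverse    : ∀ x → ¬ (x ≈ 0#) → ∃ λ y → x * y ≈ 1#
    ∣_∣ₚ       : Carrier → ℚ
    abs-cong   : ∀ {x y} → x ≈ y → ∣ x ∣ₚ ≡ ∣ y ∣ₚ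
    abs-nonneg : ∀ x → 0ℚ ℚ.≤ ∣ x ∣ₚ
    abs-zero⇒  : ∀ x → ∣ x ∣ₚ ≡ 0ℚ → x ≈ 0#
    abs-⇒zero  : ∀ x → x ≈ 0# → ∣ x ∣ₚ ≡ 0ℚ
    abs-mul    : ∀ x y → ∣ x * y ∣ₚ ≡ ∣ x ∣ₚ ℚ.* ∣ y ∣ₚ
    abs-ultra  : ∀ x y → ∣ x + y ∣ₚ ℚ.≤ (∣ x ∣ₚ ℚ.⊔ ∣ y ∣ₚ)
    ι          : ℚ → Carrier
    ι-+        : ∀ q r → ι (q ℚ.+ r) ≈ ι q + ι r
    ι-*        : ∀ q r → ι (q ℚ.* r) ≈ ι q * ι r
    ι-1        : ι 1ℚ ≈ 1#
    -- on ℚ the absolute value is the p-adic one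
    abs-ι-p    : ∣ ι ((+ p) ℚ./ 1) ∣ₚ ≡ invp p pr
    abs-ι-unit : ∀ (m : ℤ) → Coprime ℤ.∣ m ∣ p → ∣ ι (m ℚ./ 1) ∣ₚ ≡ 1ℚ
    dense      : ∀ x (ε : ℚ) → 0ℚ ℚ.< ε → ∃ λ q → ∣ x - ι q ∣ₚ ℚ.< ε
    complete   : ∀ (f : ℕ → Carrier) →
                 (∀ (ε : ℚ) → 0ℚ ℚ.< ε → ∃ λ N → ∀ m k → N ≤ m → N ≤ k →
                    ∣ f m - f k ∣ₚ ℚ.< ε) →
                 ∃ λ x → ∀ (ε : ℚ) → 0ℚ ℚ.< ε → ∃ λ N → ∀ m → N ≤ m →
                    ∣ f m - x ∣ₚ ℚ.< ε

InY : (p : ℕ) → ℚ → Set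
InY p q = (∃ λ k → ↧ₙ q ≡ p ^ k) ×
          (ℚ.- ((+ p) ℚ./ 2) ℚ.< q) × (q ℚ.< (+ p) ℚ./ 2)

-- The BCF algorithm run for n steps on α, producing complete quotients
-- γ 0, …, γ n and partial quotients a 0, …, a n (so α has at least n+1
-- partial quotients).  a j = s(γ j) is expressed by a j ∈ 𝒴 and
-- ∣ γ j - a j ∣ < 1 (s(γ) is the unique such element), and
-- γ (j+1) = 1/(γ j - a j) by γ (j+1) * (γ j - a j) ≈ 1 (which also forces
-- γ j ≠ a j for j < n).
record BCF {p : ℕ} {pr : Prime p} {c ℓ : Level} (K : Qp p pr c ℓ)
           (α : Qp.Carrier K) (n : ℕ) (a : ℕ → ℚ) (γ : ℕ → Qp.Carrier K)
           : Set ℓ where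
  open Qp K
  field
    start  : γ 0 ≈ α
    digit  : ∀ j → j ≤ n → InY p (a j)
    close  : ∀ j → j ≤ n → ∣ γ j - ι (a j) ∣ₚ ℚ.< 1ℚ
    step   : ∀ j → j < n → γ (suc j) * (γ j - ι (a j)) ≈ 1#

-- Convergent numerators/denominators, shifted by one:
-- A' k = A_{k-1}, B' k = B_{k-1}.
A' : (ℕ → ℚ) → ℕ → ℚ
A' a zero = 1ℚ
A' a (suc zero) = a 0
A' a (suc (suc k)) = a (suc k) ℚ.* A' a (suc k) ℚ.+ A' a k

B' : (ℕ → ℚ) → ℕ → ℚ
B' a zero = 0ℚ
B' a (suc zero) = 1ℚ
B' a (suc (suc k)) = a (suc k) ℚ.* B' a (suc k) ℚ.+ B' a k

-- Total division (B_n ≠ 0 for genuine BCF expansions; the 0 branch is junk).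
_÷₀_ : ℚ → ℚ → ℚ
x ÷₀ y with y ℚ.≟ 0ℚ
... | yes _ = 0ℚ
... | no y≢0 = _÷_ x y {{≢-nonZero y≢0}}

convergent : (ℕ → ℚ) → ℕ → ℚ
convergent a n = A' a (suc n) ÷₀ B' a (suc n)

{-# OPTIONS --safe #-}
-- With the complete quotient γₙ one has α = (A_{n-1} γₙ + A_{n-2}) / (B_{n-1} γₙ + B_{n-2}), and
-- the determinant identity A_k B_{k-1} - A_{k-1} B_k = ±1 turns this into
-- (α - Qₙ) · (B_{n-1} γₙ + B_{n-2}) · Bₙ = ±(γₙ - aₙ), which has absolute value < 1.
-- For j ≥ 1 the complete quotient γⱼ is the inverse of something of absolute value < 1, so
-- |aⱼ| = |γⱼ| > 1, hence |aⱼ| ≥ p since aⱼ ∈ ℤ[1/p]. The strong triangle inequality then gives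
-- |Bₙ| ≥ pⁿ and |B_{n-1} γₙ + B_{n-2}| ≥ |Bₙ|, so |α - Qₙ| < p^{-2n}. The same holds for β with
-- the same Qₙ, and the ultrametric inequality finishes.
module Submission where

open import Defs
open import Level using (Level)
open import Data.Nat using (ℕ; _<_)
open import Data.Nat.Primality using (Prime)
open import Data.Rational as ℚ using (ℚ)
open import Relation.Binary.PropositionalEquality using (_≡_)

open import Algebra.Bundles using (CommutativeRing)
open import Data.Empty using (⊥-elim)
open import Data.Integer as ℤ using (+_; -[1+_])
import Data.Integer.Properties as ℤP
open import Data.Integer.Tactic.RingSolver using (solve-∀)
open import Data.Nat as ℕ using (zero; suc; _≤_)
import Data.Nat.Properties as ℕP
open import Data.Nat.Coprimality as Coprimality using (Coprime; 1-coprimeTo)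
open import Data.Nat.Divisibility using (_∣_; ∣-trans; m∣m*n)
open import Data.Nat.Primality using (prime⇒nonZero)
open import Data.Product using (_,_)
open import Data.Rational using (mkℚ; 0ℚ; 1ℚ; ↥_; ↧ₙ_; toℚᵘ)
import Data.Rational.Properties as ℚP
open import Data.Rational.Solver using (module +-*-Solver)
open import Data.Rational.Unnormalised as ℚᵘ using (mkℚᵘ; *≡*) renaming (_≃_ to _≃ᵘ_)
import Data.Rational.Unnormalised.Properties as ℚᵘP
open import Data.Sum using (inj₁; inj₂)
open import Relation.Binary.PropositionalEquality as ≡ using (_≢_)
open import Relation.Nullary using (yes; no)
import Relation.Binary.Reasoning.Setoid as SetoidReasoning

toℚᵘ-/1 : ∀ i → toℚᵘ (i ℚ./ 1) ≃ᵘ mkℚᵘ i 0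
toℚᵘ-/1 i = ℚP.toℚᵘ-fromℚᵘ (mkℚᵘ i 0)

/1-+ : ∀ i j → (i ℤ.+ j) ℚ./ 1 ≡ i ℚ./ 1 ℚ.+ j ℚ./ 1
/1-+ i j = ℚP.toℚᵘ-injective (begin
  toℚᵘ ((i ℤ.+ j) ℚ./ 1)                ≈⟨ toℚᵘ-/1 (i ℤ.+ j) ⟩
  mkℚᵘ (i ℤ.+ j) 0                      ≈⟨ *≡* (clear-denominators i j) ⟩
  mkℚᵘ i 0 ℚᵘ.+ mkℚᵘ j 0                ≈⟨ ℚᵘP.+-cong (toℚᵘ-/1 i) (toℚᵘ-/1 j) ⟨
  toℚᵘ (i ℚ./ 1) ℚᵘ.+ toℚᵘ (j ℚ./ 1)    ≈⟨ ℚP.toℚᵘ-homo-+ (i ℚ./ 1) (j ℚ./ 1) ⟨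
  toℚᵘ (i ℚ./ 1 ℚ.+ j ℚ./ 1)            ∎)
  where
  open ℚᵘP.≃-Reasoning
  clear-denominators : ∀ i j → (i ℤ.+ j) ℤ.* + 1 ≡ (i ℤ.* + 1 ℤ.+ j ℤ.* + 1) ℤ.* + 1
  clear-denominators = solve-∀

/1-* : ∀ i j → (i ℤ.* j) ℚ./ 1 ≡ (i ℚ./ 1) ℚ.* (j ℚ./ 1)
/1-* i j = ℚP.toℚᵘ-injective (begin
  toℚᵘ ((i ℤ.* j) ℚ./ 1)                ≈⟨ toℚᵘ-/1 (i ℤ.* j) ⟩
  mkℚᵘ (i ℤ.* j) 0                      ≈⟨ *≡* ≡.refl ⟩
  mkℚᵘ i 0 ℚᵘ.* mkℚᵘ j 0                ≈⟨ ℚᵘP.*-cong (toℚᵘ-/1 i) (toℚᵘ-/1 j) ⟨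
  toℚᵘ (i ℚ./ 1) ℚᵘ.* toℚᵘ (j ℚ./ 1)    ≈⟨ ℚP.toℚᵘ-homo-* (i ℚ./ 1) (j ℚ./ 1) ⟨
  toℚᵘ ((i ℚ./ 1) ℚ.* (j ℚ./ 1))        ∎)
  where open ℚᵘP.≃-Reasoning

1/-* : ∀ m n .{{_ : ℕ.NonZero m}} .{{_ : ℕ.NonZero n}} →
       ((+ 1) ℚ./ (m ℕ.* n)) {{ℕP.m*n≢0 m n}} ≡ ((+ 1) ℚ./ m) ℚ.* ((+ 1) ℚ./ n)
1/-* (suc m) (suc n) = ℚP.toℚᵘ-injective (begin
  toℚᵘ ((+ 1) ℚ./ (suc m ℕ.* suc n))                 ≈⟨ ℚP.toℚᵘ-fromℚᵘ (mkℚᵘ (+ 1) (n ℕ.+ m ℕ.* suc n)) ⟩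
  mkℚᵘ (+ 1) (n ℕ.+ m ℕ.* suc n)                     ≈⟨ *≡* ≡.refl ⟩
  mkℚᵘ (+ 1) m ℚᵘ.* mkℚᵘ (+ 1) n                     ≈⟨ ℚᵘP.*-cong (ℚP.toℚᵘ-fromℚᵘ (mkℚᵘ (+ 1) m))
                                                                   (ℚP.toℚᵘ-fromℚᵘ (mkℚᵘ (+ 1) n)) ⟨
  toℚᵘ ((+ 1) ℚ./ suc m) ℚᵘ.* toℚᵘ ((+ 1) ℚ./ suc n) ≈⟨ ℚP.toℚᵘ-homo-* ((+ 1) ℚ./ suc m) ((+ 1) ℚ./ suc n) ⟨
  toℚᵘ (((+ 1) ℚ./ suc m) ℚ.* ((+ 1) ℚ./ suc n))     ∎)
  where open ℚᵘP.≃-Reasoning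

*-↧/1 : ∀ q → q ℚ.* ((+ ↧ₙ q) ℚ./ 1) ≡ (↥ q) ℚ./ 1
*-↧/1 q@(mkℚ i d _) = ℚP.toℚᵘ-injective (begin
  toℚᵘ (q ℚ.* ((+ suc d) ℚ./ 1))          ≈⟨ ℚP.toℚᵘ-homo-* q ((+ suc d) ℚ./ 1) ⟩
  mkℚᵘ i d ℚᵘ.* toℚᵘ ((+ suc d) ℚ./ 1)    ≈⟨ ℚᵘP.*-congˡ {mkℚᵘ i d} (toℚᵘ-/1 (+ suc d)) ⟩
  mkℚᵘ i d ℚᵘ.* mkℚᵘ (+ suc d) 0          ≈⟨ *≡* (ℤP.*-assoc i (+ suc d) (+ 1)) ⟩
  mkℚᵘ i 0                                ≈⟨ toℚᵘ-/1 i ⟨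
  toℚᵘ (i ℚ./ 1)                          ∎)
  where open ℚᵘP.≃-Reasoning

*-÷₀ : ∀ x {y} → y ≢ 0ℚ → y ℚ.* (x ÷₀ y) ≡ x
*-÷₀ x {y} y≢0 with y ℚ.≟ 0ℚ
... | yes y≡0 = ⊥-elim (y≢0 y≡0)
... | no  y≢0′ = begin
  y ℚ.* (x ℚ.* ℚ.1/ y)  ≡⟨ ≡.cong (y ℚ.*_) (ℚP.*-comm x (ℚ.1/ y)) ⟩
  y ℚ.* (ℚ.1/ y ℚ.* x)  ≡⟨ ℚP.*-assoc y (ℚ.1/ y) x ⟨
  y ℚ.* ℚ.1/ y ℚ.* x    ≡⟨ ≡.cong (ℚ._* x) (ℚP.*-inverseʳ y) ⟩
  1ℚ ℚ.* x              ≡⟨ ℚP.*-identityˡ x ⟩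
  x                     ∎
  where
  open ≡.≡-Reasoning
  instance
    y-nonZero : ℚ.NonZero y
    y-nonZero = ℚ.≢-nonZero y≢0′

[xy][zw]≡[xz][wy] : ∀ x y z w → (x ℚ.* y) ℚ.* (z ℚ.* w) ≡ (x ℚ.* z) ℚ.* (w ℚ.* y)
[xy][zw]≡[xz][wy] = solve 4 (λ x y z w → (x :* y) :* (z :* w) := (x :* z) :* (w :* y)) ≡.refl
  where open +-*-Solver

x[yz][yz]≡[xyy][zz] : ∀ x y z → x ℚ.* ((y ℚ.* z) ℚ.* (y ℚ.* z)) ≡ ((x ℚ.* y) ℚ.* y) ℚ.* (z ℚ.* z)
x[yz][yz]≡[xyy][zz] = solve 3 (λ x y z → x :* ((y :* z) :* (y :* z)) := ((x :* y) :* y) :* (z :* z)) ≡.refl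
  where open +-*-Solver

x*y≤x : ∀ {x y} → 0ℚ ℚ.≤ x → y ℚ.≤ 1ℚ → x ℚ.* y ℚ.≤ x
x*y≤x {x} {y} 0≤x y≤1 = ≡.subst (x ℚ.* y ℚ.≤_) (ℚP.*-identityʳ x)
  (ℚP.*-monoˡ-≤-nonNeg x {{ℚ.nonNegative 0≤x}} y≤1)

1≤x*y : ∀ {x y} → 1ℚ ℚ.≤ x → 1ℚ ℚ.≤ y → 1ℚ ℚ.≤ x ℚ.* y
1≤x*y {x} {y} 1≤x 1≤y = ℚP.≤-trans 1≤x (≡.subst (ℚ._≤ x ℚ.* y) (ℚP.*-identityʳ x)
  (ℚP.*-monoˡ-≤-nonNeg x {{ℚ.nonNegative (ℚP.≤-trans (ℚP.nonNegative⁻¹ 1ℚ) 1≤x)}} 1≤y))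

x*y≡1⇒y<1⇒1<x : ∀ {x y} → 0ℚ ℚ.≤ y → y ℚ.< 1ℚ → x ℚ.* y ≡ 1ℚ → 1ℚ ℚ.< x
x*y≡1⇒y<1⇒1<x {x} {y} 0≤y y<1 xy≡1 = ℚP.≰⇒> λ x≤1 →
  ℚP.<-irrefl xy≡1 (ℚP.≤-<-trans (xy≤y x≤1) y<1)
  where
  xy≤y : x ℚ.≤ 1ℚ → x ℚ.* y ℚ.≤ y
  xy≤y x≤1 = ≡.subst (x ℚ.* y ℚ.≤_) (ℚP.*-identityˡ y) (ℚP.*-monoʳ-≤-nonNeg y {{ℚ.nonNegative 0≤y}} x≤1)

module Continuants {c ℓ} (R : CommutativeRing c ℓ) (b : ℕ → CommutativeRing.Carrier R) where
  open CommutativeRing R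
  open import Algebra.Properties.Ring ring using (//-rightDividesˡ)
  open import Algebra.Solver.Ring.NaturalCoefficients.Default commutativeSemiring
  open import Relation.Binary.Reasoning.Setoid setoid

  continuant : Carrier → Carrier → ℕ → Carrier
  continuant x₀ x₁ zero          = x₀
  continuant x₀ x₁ (suc zero)    = x₁
  continuant x₀ x₁ (suc (suc k)) = continuant x₀ x₁ (suc k) * b k + continuant x₀ x₁ k

  -- continuant x₀ x₁ (k + 2) with its last partial quotient b k replaced by x
  extend : Carrier → Carrier → ℕ → Carrier → Carrier
  extend x₀ x₁ k x = continuant x₀ x₁ (suc k) * x + continuant x₀ x₁ k

  extend-shift : ∀ x₀ x₁ k {g h} → h * (g - b k) ≈ 1# →
                 extend x₀ x₁ k g * h ≈ extend x₀ x₁ (suc k) h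
  extend-shift x₀ x₁ k {g} {h} h[g-b]≈1 = begin
    (c₁ * g + c₀) * h             ≈⟨ solve 4 (λ c₁ c₀ g h → (c₁ :* g :+ c₀) :* h := c₁ :* (h :* g) :+ c₀ :* h)
                                             refl c₁ c₀ g h ⟩
    c₁ * (h * g) + c₀ * h         ≈⟨ +-congʳ (*-congˡ hg≈hb+1) ⟩
    c₁ * (h * b k + 1#) + c₀ * h  ≈⟨ solve 4 (λ c₁ c₀ h y → c₁ :* (h :* y :+ con 1) :+ c₀ :* h
                                                         := (c₁ :* y :+ c₀) :* h :+ c₁)
                                             refl c₁ c₀ h (b k) ⟩
    (c₁ * b k + c₀) * h + c₁      ∎
    where
    c₁ c₀ : Carrier
    c₁ = continuant x₀ x₁ (suc k)
    c₀ = continuant x₀ x₁ k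
    hg≈hb+1 : h * g ≈ h * b k + 1#
    hg≈hb+1 = begin
      h * g                    ≈⟨ *-congˡ (//-rightDividesˡ (b k) g) ⟨
      h * ((g - b k) + b k)    ≈⟨ distribˡ h (g - b k) (b k) ⟩
      h * (g - b k) + h * b k  ≈⟨ +-congʳ h[g-b]≈1 ⟩
      1# + h * b k             ≈⟨ +-comm 1# (h * b k) ⟩
      h * b k + 1#             ∎

  extend-+ : ∀ x₀ x₁ k x d → extend x₀ x₁ k (x + d) ≈ extend x₀ x₁ k x + continuant x₀ x₁ (suc k) * d
  extend-+ x₀ x₁ k x d =
    solve 4 (λ c₁ c₀ x d → c₁ :* (x :+ d) :+ c₀ := c₁ :* x :+ c₀ :+ c₁ :* d)
            refl (continuant x₀ x₁ (suc k)) (continuant x₀ x₁ k) x d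

  -- A (k + 2) and B (k + 2) are the paper's A_k and B_k; the first two values
  -- are A_{-2}, A_{-1} = 0, 1 and B_{-2}, B_{-1} = 1, 0.
  A B : ℕ → Carrier
  A = continuant 0# 1#
  B = continuant 1# 0#

  Aₓ Bₓ : ℕ → Carrier → Carrier
  Aₓ = extend 0# 1#
  Bₓ = extend 1# 0#

  sign : ℕ → Carrier
  sign zero    = 1#
  sign (suc k) = - sign k

  -- The solver only knows the semiring operations, so - s enters as an atom
  -- cancelled against s by hand.
  determinant : ∀ k → A (suc k) * B k ≈ A k * B (suc k) + sign k
  determinant zero = begin
    1# * 1#       ≈⟨ *-identityˡ 1# ⟩
    1#            ≈⟨ +-identityˡ 1# ⟨
    0# + 1#       ≈⟨ +-congʳ (zeroˡ 0#) ⟨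
    0# * 0# + 1#  ∎
  determinant (suc k) = begin
    (a₁ * b k + a₀) * b₁                     ≈⟨ solve 4 (λ a₁ a₀ b₁ y → (a₁ :* y :+ a₀) :* b₁
                                                                    := y :* (a₁ :* b₁) :+ a₀ :* b₁)
                                                        refl a₁ a₀ b₁ (b k) ⟩
    b k * (a₁ * b₁) + a₀ * b₁                ≈⟨ +-congˡ (+-identityʳ _) ⟨
    b k * (a₁ * b₁) + (a₀ * b₁ + 0#)         ≈⟨ +-congˡ (+-congˡ (-‿inverseʳ s)) ⟨
    b k * (a₁ * b₁) + (a₀ * b₁ + (s + - s))  ≈⟨ solve 5 (λ u v y s s′ → y :* u :+ (v :+ (s :+ s′))
                                                                   := y :* u :+ (v :+ s) :+ s′)
                                                        refl (a₁ * b₁) (a₀ * b₁) (b k) s (- s) ⟩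
    b k * (a₁ * b₁) + (a₀ * b₁ + s) + - s    ≈⟨ +-congʳ (+-congˡ (determinant k)) ⟨
    b k * (a₁ * b₁) + a₁ * b₀ + - s          ≈⟨ +-congʳ (solve 4 (λ a₁ b₁ b₀ y → y :* (a₁ :* b₁) :+ a₁ :* b₀
                                                                             := a₁ :* (b₁ :* y :+ b₀))
                                                                 refl a₁ b₁ b₀ (b k)) ⟩
    a₁ * (b₁ * b k + b₀) + - s               ∎
    where
    a₁ a₀ b₁ b₀ s : Carrier
    a₁ = A (suc k)
    a₀ = A k
    b₁ = B (suc k)
    b₀ = B k
    s = sign k

  cross : ∀ k x d → Aₓ k (x + d) * Bₓ k x ≈ Aₓ k x * Bₓ k (x + d) + d * sign k
  cross k x d = begin
    (a₁ * (x + d) + a₀) * (b₁ * x + b₀)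
      ≈⟨ solve 6 (λ a₁ a₀ b₁ b₀ x d → (a₁ :* (x :+ d) :+ a₀) :* (b₁ :* x :+ b₀)
                                   := (a₁ :* x :+ a₀) :* (b₁ :* x :+ b₀) :+ a₁ :* b₁ :* x :* d :+ a₁ :* b₀ :* d)
                 refl a₁ a₀ b₁ b₀ x d ⟩
    (a₁ * x + a₀) * (b₁ * x + b₀) + a₁ * b₁ * x * d + a₁ * b₀ * d
      ≈⟨ +-congˡ (*-congʳ (determinant k)) ⟩
    (a₁ * x + a₀) * (b₁ * x + b₀) + a₁ * b₁ * x * d + (a₀ * b₁ + sign k) * d
      ≈⟨ solve 7 (λ a₁ a₀ b₁ b₀ x d s → (a₁ :* x :+ a₀) :* (b₁ :* x :+ b₀) :+ a₁ :* b₁ :* x :* d :+ (a₀ :* b₁ :+ s) :* d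
                                     := (a₁ :* x :+ a₀) :* (b₁ :* (x :+ d) :+ b₀) :+ d :* s)
                 refl a₁ a₀ b₁ b₀ x d (sign k) ⟩
    (a₁ * x + a₀) * (b₁ * (x + d) + b₀) + d * sign k
      ∎
    where
    a₁ a₀ b₁ b₀ : Carrier
    a₁ = A (suc k)
    a₀ = A k
    b₁ = B (suc k)
    b₀ = B k

  complete-quotient-formula : ∀ (γ : ℕ → Carrier) {x} → γ 0 ≈ x → ∀ k →
    (∀ j → j ℕ.< k → γ (suc j) * (γ j - b j) ≈ 1#) → x * Bₓ k (γ k) ≈ Aₓ k (γ k)
  complete-quotient-formula γ {x} γ₀≈x zero _ = begin
    x * (0# * γ 0 + 1#)  ≈⟨ *-congˡ (trans (+-congʳ (zeroˡ (γ 0))) (+-identityˡ 1#)) ⟩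
    x * 1#               ≈⟨ *-identityʳ x ⟩
    x                    ≈⟨ γ₀≈x ⟨
    γ 0                  ≈⟨ trans (+-identityʳ _) (*-identityˡ (γ 0)) ⟨
    1# * γ 0 + 0#        ∎
  complete-quotient-formula γ {x} γ₀≈x (suc k) steps = begin
    x * Bₓ (suc k) h  ≈⟨ *-congˡ (extend-shift 1# 0# k step) ⟨
    x * (Bₓ k g * h)  ≈⟨ *-assoc x (Bₓ k g) h ⟨
    x * Bₓ k g * h    ≈⟨ *-congʳ (complete-quotient-formula γ γ₀≈x k (λ j j<k → steps j (ℕP.m<n⇒m<1+n j<k))) ⟩
    Aₓ k g * h        ≈⟨ extend-shift 0# 1# k step ⟩
    Aₓ (suc k) h      ∎
    where
    g h : Carrier
    g = γ k
    h = γ (suc k)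
    step : h * (g - b k) ≈ 1#
    step = steps k (ℕP.n<1+n k)

module ValuedField {p : ℕ} {pr : Prime p} {c ℓ : Level} (K : Qp p pr c ℓ) where
  open Qp K
  open import Algebra.Properties.Ring ring
    using (x+x≈x⇒x≈0; +-inverseʳ-unique; -1*x≈-x; ⁻¹-anti-homo‿-; //-rightDividesˡ; //-rightDividesʳ)
  open import Algebra.Properties.Semiring.Exp semiring public using (_^_; ^-homo-*)

  private instance
    p≢0 : ℕ.NonZero p
    p≢0 = prime⇒nonZero pr

  ι-cong : ∀ {q r} → q ≡ r → ι q ≈ ι r
  ι-cong q≡r = reflexive (≡.cong ι q≡r)

  ι-0 : ι 0ℚ ≈ 0#
  ι-0 = x+x≈x⇒x≈0 (ι 0ℚ) (sym (ι-+ 0ℚ 0ℚ))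

  ι-neg : ∀ q → ι (ℚ.- q) ≈ - ι q
  ι-neg q = +-inverseʳ-unique (ι q) (ι (ℚ.- q)) (begin
    ι q + ι (ℚ.- q)  ≈⟨ ι-+ q (ℚ.- q) ⟨
    ι (q ℚ.- q)      ≈⟨ ι-cong (ℚP.+-inverseʳ q) ⟩
    ι 0ℚ             ≈⟨ ι-0 ⟩
    0#               ∎)
    where open SetoidReasoning setoid

  ∣0∣ : ∣ 0# ∣ₚ ≡ 0ℚ
  ∣0∣ = abs-⇒zero 0# refl

  ∣1∣ : ∣ 1# ∣ₚ ≡ 1ℚ
  ∣1∣ = ≡.trans (abs-cong (sym ι-1)) (abs-ι-unit (+ 1) (1-coprimeTo p))

  ∣-x∣ : ∀ x → ∣ - x ∣ₚ ≡ ∣ x ∣ₚ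
  ∣-x∣ x = begin
    ∣ - x ∣ₚ              ≡⟨ abs-cong (-1*x≈-x x) ⟨
    ∣ - 1# * x ∣ₚ         ≡⟨ abs-mul (- 1#) x ⟩
    ∣ - 1# ∣ₚ ℚ.* ∣ x ∣ₚ  ≡⟨ ≡.cong (ℚ._* ∣ x ∣ₚ) ∣-1∣ ⟩
    1ℚ ℚ.* ∣ x ∣ₚ         ≡⟨ ℚP.*-identityˡ ∣ x ∣ₚ ⟩
    ∣ x ∣ₚ                ∎
    where
    open ≡.≡-Reasoning
    ∣-1∣ : ∣ - 1# ∣ₚ ≡ 1ℚ
    ∣-1∣ = ≡.trans (abs-cong (trans (-‿cong (sym ι-1)) (sym (ι-neg 1ℚ))))
                   (abs-ι-unit -[1+ 0 ] (1-coprimeTo p))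

  ∣x-y∣≡∣y-x∣ : ∀ x y → ∣ x - y ∣ₚ ≡ ∣ y - x ∣ₚ
  ∣x-y∣≡∣y-x∣ x y = ≡.trans (≡.sym (∣-x∣ (x - y))) (abs-cong (⁻¹-anti-homo‿- x y))

  abs-*-monoˡ-≤ : ∀ x {r s} → r ℚ.≤ s → ∣ x ∣ₚ ℚ.* r ℚ.≤ ∣ x ∣ₚ ℚ.* s
  abs-*-monoˡ-≤ x = ℚP.*-monoˡ-≤-nonNeg ∣ x ∣ₚ {{ℚ.nonNegative (abs-nonneg x)}}

  abs-*-monoʳ-≤ : ∀ x {r s} → r ℚ.≤ s → r ℚ.* ∣ x ∣ₚ ℚ.≤ s ℚ.* ∣ x ∣ₚ
  abs-*-monoʳ-≤ x = ℚP.*-monoʳ-≤-nonNeg ∣ x ∣ₚ {{ℚ.nonNegative (abs-nonneg x)}}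

  ∣x∣≤∣x+y∣⊔∣y∣ : ∀ x y → ∣ x ∣ₚ ℚ.≤ ∣ x + y ∣ₚ ℚ.⊔ ∣ y ∣ₚ
  ∣x∣≤∣x+y∣⊔∣y∣ x y = ≡.subst₂ ℚ._≤_
    (abs-cong (//-rightDividesʳ y x)) (≡.cong (∣ x + y ∣ₚ ℚ.⊔_) (∣-x∣ y)) (abs-ultra (x + y) (- y))

  abs-+-dominant : ∀ {x y} → ∣ y ∣ₚ ℚ.< ∣ x ∣ₚ → ∣ x ∣ₚ ℚ.≤ ∣ x + y ∣ₚ
  abs-+-dominant {x} {y} ∣y∣<∣x∣ with ℚP.≤-total ∣ x + y ∣ₚ ∣ y ∣ₚ
  ... | inj₁ ∣x+y∣≤∣y∣ = ⊥-elim (ℚP.<-irrefl ≡.refl (ℚP.≤-<-trans ∣x∣≤∣y∣ ∣y∣<∣x∣))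
    where
    ∣x∣≤∣y∣ : ∣ x ∣ₚ ℚ.≤ ∣ y ∣ₚ
    ∣x∣≤∣y∣ = ≡.subst (∣ x ∣ₚ ℚ.≤_) (ℚP.p≤q⇒p⊔q≡q ∣x+y∣≤∣y∣) (∣x∣≤∣x+y∣⊔∣y∣ x y)
  ... | inj₂ ∣y∣≤∣x+y∣ = ≡.subst (∣ x ∣ₚ ℚ.≤_) (ℚP.p≥q⇒p⊔q≡p ∣y∣≤∣x+y∣) (∣x∣≤∣x+y∣⊔∣y∣ x y)

  abs-+-< : ∀ {x y r} → ∣ x ∣ₚ ℚ.< r → ∣ y ∣ₚ ℚ.< r → ∣ x + y ∣ₚ ℚ.< r
  abs-+-< {x} {y} ∣x∣<r ∣y∣<r with ℚP.≤-total ∣ x ∣ₚ ∣ y ∣ₚ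
  ... | inj₁ ∣x∣≤∣y∣ =
    ℚP.≤-<-trans (≡.subst (∣ x + y ∣ₚ ℚ.≤_) (ℚP.p≤q⇒p⊔q≡q ∣x∣≤∣y∣) (abs-ultra x y)) ∣y∣<r
  ... | inj₂ ∣y∣≤∣x∣ =
    ℚP.≤-<-trans (≡.subst (∣ x + y ∣ₚ ℚ.≤_) (ℚP.p≥q⇒p⊔q≡p ∣y∣≤∣x∣) (abs-ultra x y)) ∣x∣<r

  abs-sub-< : ∀ {x y z r} → ∣ x - z ∣ₚ ℚ.< r → ∣ z - y ∣ₚ ℚ.< r → ∣ x - y ∣ₚ ℚ.< r
  abs-sub-< {x} {y} {z} ∣x-z∣<r ∣z-y∣<r =
    ≡.subst (ℚ._< _) (abs-cong x-z+z-y≈x-y) (abs-+-< ∣x-z∣<r ∣z-y∣<r)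
    where
    x-z+z-y≈x-y : (x - z) + (z - y) ≈ x - y
    x-z+z-y≈x-y = trans (sym (+-assoc (x - z) z (- y))) (+-congʳ (//-rightDividesˡ z x))

  ∣ι-ℕ∣≤1 : ∀ n → ∣ ι (+ n ℚ./ 1) ∣ₚ ℚ.≤ 1ℚ
  ∣ι-ℕ∣≤1 zero    = ℚP.≤-trans (ℚP.≤-reflexive (≡.trans (abs-cong ι-0) ∣0∣)) (ℚP.nonNegative⁻¹ 1ℚ)
  ∣ι-ℕ∣≤1 (suc n) = begin
    ∣ ι (+ suc n ℚ./ 1) ∣ₚ             ≡⟨ abs-cong (trans (ι-cong (/1-+ (+ 1) (+ n))) (ι-+ 1ℚ (+ n ℚ./ 1))) ⟩
    ∣ ι 1ℚ + ι (+ n ℚ./ 1) ∣ₚ          ≤⟨ abs-ultra (ι 1ℚ) (ι (+ n ℚ./ 1)) ⟩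
    ∣ ι 1ℚ ∣ₚ ℚ.⊔ ∣ ι (+ n ℚ./ 1) ∣ₚ   ≤⟨ ℚP.⊔-lub (ℚP.≤-reflexive (≡.trans (abs-cong ι-1) ∣1∣)) (∣ι-ℕ∣≤1 n) ⟩
    1ℚ                                 ∎
    where open ℚP.≤-Reasoning

  ∣ι-ℤ∣≤1 : ∀ m → ∣ ι (m ℚ./ 1) ∣ₚ ℚ.≤ 1ℚ
  ∣ι-ℤ∣≤1 (+ n)    = ∣ι-ℕ∣≤1 n
  ∣ι-ℤ∣≤1 -[1+ n ] =
    ≡.subst (ℚ._≤ 1ℚ) (≡.trans (≡.sym (∣-x∣ _)) (abs-cong (sym (ι-neg _)))) (∣ι-ℕ∣≤1 (suc n))

  π : Carrier
  π = ι (+ p ℚ./ 1)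

  ∣π^k∣≤1 : ∀ k → ∣ π ^ k ∣ₚ ℚ.≤ 1ℚ
  ∣π^[1+k]∣≤∣π∣ : ∀ k → ∣ π ^ suc k ∣ₚ ℚ.≤ ∣ π ∣ₚ

  ∣π^k∣≤1 zero    = ℚP.≤-reflexive ∣1∣
  ∣π^k∣≤1 (suc k) = ℚP.≤-trans (∣π^[1+k]∣≤∣π∣ k) (∣ι-ℕ∣≤1 p)

  ∣π^[1+k]∣≤∣π∣ k =
    ≡.subst (ℚ._≤ ∣ π ∣ₚ) (≡.sym (abs-mul π (π ^ k))) (x*y≤x (abs-nonneg π) (∣π^k∣≤1 k))

  1/p^ : ℕ → ℚ
  1/p^ k = ((+ 1) ℚ./ (p ℕ.^ k)) {{ℕP.m^n≢0 p k}}

  ∣π^k∣≡1/p^k : ∀ k → ∣ π ^ k ∣ₚ ≡ 1/p^ k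
  ∣π^k∣≡1/p^k zero    = ∣1∣
  ∣π^k∣≡1/p^k (suc k) = begin
    ∣ π * π ^ k ∣ₚ             ≡⟨ abs-mul π (π ^ k) ⟩
    ∣ π ∣ₚ ℚ.* ∣ π ^ k ∣ₚ      ≡⟨ ≡.cong₂ ℚ._*_ abs-ι-p (∣π^k∣≡1/p^k k) ⟩
    ((+ 1) ℚ./ p) ℚ.* 1/p^ k   ≡⟨ 1/-* p (p ℕ.^ k) {{p≢0}} {{ℕP.m^n≢0 p k}} ⟨
    1/p^ (suc k)               ∎
    where open ≡.≡-Reasoning

  0<∣π^k∣ : ∀ k → 0ℚ ℚ.< ∣ π ^ k ∣ₚ
  0<∣π^k∣ k = ≡.subst (0ℚ ℚ.<_) (≡.sym (∣π^k∣≡1/p^k k))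
    (ℚP.positive⁻¹ (1/p^ k) {{ℚP.normalize-pos 1 (p ℕ.^ k) {{ℕP.m^n≢0 p k}}}})

  invp2n≡∣π^n∣² : ∀ n → invp2n p pr n ≡ ∣ π ^ n ∣ₚ ℚ.* ∣ π ^ n ∣ₚ
  invp2n≡∣π^n∣² n = begin
    invp2n p pr n                      ≡⟨ ∣π^k∣≡1/p^k (2 ℕ.* n) ⟨
    ∣ π ^ (n ℕ.+ (n ℕ.+ 0)) ∣ₚ         ≡⟨ abs-cong (^-homo-* π n (n ℕ.+ 0)) ⟩
    ∣ π ^ n * π ^ (n ℕ.+ 0) ∣ₚ         ≡⟨ abs-mul (π ^ n) (π ^ (n ℕ.+ 0)) ⟩
    ∣ π ^ n ∣ₚ ℚ.* ∣ π ^ (n ℕ.+ 0) ∣ₚ  ≡⟨ ≡.cong (λ k → ∣ π ^ n ∣ₚ ℚ.* ∣ π ^ k ∣ₚ) (ℕP.+-identityʳ n) ⟩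
    ∣ π ^ n ∣ₚ ℚ.* ∣ π ^ n ∣ₚ          ∎
    where open ≡.≡-Reasoning

  ι-p^ : ∀ e → ι (+ (p ℕ.^ e) ℚ./ 1) ≈ π ^ e
  ι-p^ zero    = ι-1
  ι-p^ (suc e) = begin
    ι (+ (p ℕ.* p ℕ.^ e) ℚ./ 1)              ≈⟨ ι-cong (≡.cong (ℚ._/ 1) (ℤP.pos-* p (p ℕ.^ e))) ⟩
    ι ((+ p ℤ.* + (p ℕ.^ e)) ℚ./ 1)          ≈⟨ ι-cong (/1-* (+ p) (+ (p ℕ.^ e))) ⟩
    ι ((+ p ℚ./ 1) ℚ.* (+ (p ℕ.^ e) ℚ./ 1))  ≈⟨ ι-* (+ p ℚ./ 1) (+ (p ℕ.^ e) ℚ./ 1) ⟩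
    π * ι (+ (p ℕ.^ e) ℚ./ 1)                ≈⟨ *-congˡ (ι-p^ e) ⟩
    π * π ^ e                                ∎
    where open SetoidReasoning setoid

  ∣ιq∣*∣π^e∣≡∣ι↥q∣ : ∀ q e → ↧ₙ q ≡ p ℕ.^ e →
                     ∣ ι q ∣ₚ ℚ.* ∣ π ^ e ∣ₚ ≡ ∣ ι (↥ q ℚ./ 1) ∣ₚ
  ∣ιq∣*∣π^e∣≡∣ι↥q∣ q e ↧q≡p^e = begin
    ∣ ι q ∣ₚ ℚ.* ∣ π ^ e ∣ₚ        ≡⟨ abs-mul (ι q) (π ^ e) ⟨
    ∣ ι q * π ^ e ∣ₚ               ≡⟨ abs-cong (*-congˡ ι↧q≈π^e) ⟨
    ∣ ι q * ι (+ ↧ₙ q ℚ./ 1) ∣ₚ    ≡⟨ abs-cong (ι-* q (+ ↧ₙ q ℚ./ 1)) ⟨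
    ∣ ι (q ℚ.* (+ ↧ₙ q ℚ./ 1)) ∣ₚ  ≡⟨ abs-cong (ι-cong (*-↧/1 q)) ⟩
    ∣ ι (↥ q ℚ./ 1) ∣ₚ             ∎
    where
    open ≡.≡-Reasoning
    ι↧q≈π^e : ι (+ ↧ₙ q ℚ./ 1) ≈ π ^ e
    ι↧q≈π^e = trans (ι-cong (≡.cong (λ k → + k ℚ./ 1) ↧q≡p^e)) (ι-p^ e)

  1<∣ι∣⇒1≤∣ι∣*∣π∣ : ∀ q e → ↧ₙ q ≡ p ℕ.^ e → 1ℚ ℚ.< ∣ ι q ∣ₚ → 1ℚ ℚ.≤ ∣ ι q ∣ₚ ℚ.* ∣ π ∣ₚ
  1<∣ι∣⇒1≤∣ι∣*∣π∣ q zero ↧q≡1 1<∣ιq∣ =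
    ⊥-elim (ℚP.<-irrefl ≡.refl (ℚP.<-≤-trans 1<∣ιq∣ ∣ιq∣≤1))
    where
    open ℚP.≤-Reasoning
    ∣ιq∣≤1 : ∣ ι q ∣ₚ ℚ.≤ 1ℚ
    ∣ιq∣≤1 = begin
      ∣ ι q ∣ₚ                 ≡⟨ ℚP.*-identityʳ ∣ ι q ∣ₚ ⟨
      ∣ ι q ∣ₚ ℚ.* 1ℚ          ≡⟨ ≡.cong (∣ ι q ∣ₚ ℚ.*_) ∣1∣ ⟨
      ∣ ι q ∣ₚ ℚ.* ∣ π ^ 0 ∣ₚ  ≡⟨ ∣ιq∣*∣π^e∣≡∣ι↥q∣ q 0 ↧q≡1 ⟩
      ∣ ι (↥ q ℚ./ 1) ∣ₚ       ≤⟨ ∣ι-ℤ∣≤1 (↥ q) ⟩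
      1ℚ                       ∎
  1<∣ι∣⇒1≤∣ι∣*∣π∣ q@(mkℚ _ _ ↥q⊥↧q) (suc e) ↧q≡p^e _ = begin
    1ℚ                           ≡⟨ abs-ι-unit (↥ q) ↥q⊥p ⟨
    ∣ ι (↥ q ℚ./ 1) ∣ₚ           ≡⟨ ∣ιq∣*∣π^e∣≡∣ι↥q∣ q (suc e) ↧q≡p^e ⟨
    ∣ ι q ∣ₚ ℚ.* ∣ π ^ suc e ∣ₚ  ≤⟨ abs-*-monoˡ-≤ (ι q) (∣π^[1+k]∣≤∣π∣ e) ⟩
    ∣ ι q ∣ₚ ℚ.* ∣ π ∣ₚ          ∎
    where
    open ℚP.≤-Reasoning
    ↥q⊥p : Coprime ℤ.∣ ↥ q ∣ p
    ↥q⊥p {d} (d∣↥q , d∣p) = Coprimality.recompute ↥q⊥↧q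
      (d∣↥q , ≡.subst (d ∣_) (≡.sym ↧q≡p^e) (∣-trans d∣p (m∣m*n (p ℕ.^ e))))

module Expansion {p : ℕ} {pr : Prime p} {c ℓ : Level} (K : Qp p pr c ℓ)
                 {n : ℕ} {α : Qp.Carrier K} {a : ℕ → ℚ} {γ : ℕ → Qp.Carrier K}
                 (bcf : BCF K α n a γ) where
  open Qp K
  open ValuedField K
  open BCF bcf renaming (start to γ₀≈α)
  open Continuants cring (λ j → ι (a j))
  open import Algebra.Properties.Ring ring using (//-rightDividesˡ; +-cancelʳ)
  open import Algebra.Solver.Ring.NaturalCoefficients.Default commutativeSemiring

  ι-continuant : ∀ (w : ℕ → ℚ) {x₀ x₁} →
    (∀ k → w (suc (suc k)) ≡ a (suc k) ℚ.* w (suc k) ℚ.+ w k) →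
    ι (w 0) ≈ x₁ → ι (w 1) ≈ x₁ * ι (a 0) + x₀ →
    ∀ k → ι (w k) ≈ continuant x₀ x₁ (suc k)
  ι-continuant w rec w₀ w₁ zero          = w₀
  ι-continuant w rec w₀ w₁ (suc zero)    = w₁
  ι-continuant w {x₀} {x₁} rec w₀ w₁ (suc (suc k)) = begin
    ι (w (suc (suc k)))                      ≈⟨ ι-cong (rec k) ⟩
    ι (a (suc k) ℚ.* w (suc k) ℚ.+ w k)      ≈⟨ trans (ι-+ _ (w k)) (+-congʳ (ι-* (a (suc k)) (w (suc k)))) ⟩
    ι (a (suc k)) * ι (w (suc k)) + ι (w k)  ≈⟨ +-cong (*-congˡ (ι-continuant w rec w₀ w₁ (suc k)))
                                                        (ι-continuant w rec w₀ w₁ k) ⟩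
    ι (a (suc k)) * c₂ + c₁                  ≈⟨ +-congʳ (*-comm (ι (a (suc k))) c₂) ⟩
    c₂ * ι (a (suc k)) + c₁                  ∎
    where
    open SetoidReasoning setoid
    c₂ c₁ : Carrier
    c₂ = continuant x₀ x₁ (suc (suc k))
    c₁ = continuant x₀ x₁ (suc k)

  ι-A' : ∀ k → ι (A' a k) ≈ A (suc k)
  ι-A' = ι-continuant (A' a) (λ _ → ≡.refl) ι-1 (sym (trans (+-identityʳ _) (*-identityˡ _)))

  ι-B' : ∀ k → ι (B' a k) ≈ B (suc k)
  ι-B' = ι-continuant (B' a) (λ _ → ≡.refl) ι-0
           (sym (trans (+-congʳ (zeroˡ _)) (trans (+-identityˡ 1#) (sym ι-1))))

  1<∣γ∣ : ∀ k → k < n → 1ℚ ℚ.< ∣ γ (suc k) ∣ₚ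
  1<∣γ∣ k k<n = x*y≡1⇒y<1⇒1<x (abs-nonneg _) (close k (ℕP.<⇒≤ k<n))
    (≡.trans (≡.sym (abs-mul _ _)) (≡.trans (abs-cong (step k k<n)) ∣1∣))

  1<∣a∣ : ∀ k → k < n → 1ℚ ℚ.< ∣ ι (a (suc k)) ∣ₚ
  1<∣a∣ k k<n = ℚP.<-≤-trans (1<∣γ∣ k k<n)
    (≡.subst (∣ g ∣ₚ ℚ.≤_) (abs-cong (trans (+-comm g (x - g)) (//-rightDividesˡ g x)))
      (abs-+-dominant (≡.subst (ℚ._< ∣ g ∣ₚ) (∣x-y∣≡∣y-x∣ g x)
        (ℚP.<-trans (close (suc k) k<n) (1<∣γ∣ k k<n)))))
    where
    g x : Carrier
    g = γ (suc k)
    x = ι (a (suc k))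

  1≤∣a∣*∣π∣ : ∀ k → k < n → 1ℚ ℚ.≤ ∣ ι (a (suc k)) ∣ₚ ℚ.* ∣ π ∣ₚ
  1≤∣a∣*∣π∣ k k<n with digit (suc k) k<n
  ... | (e , ↧a≡p^e) , _ = 1<∣ι∣⇒1≤∣ι∣*∣π∣ (a (suc k)) e ↧a≡p^e (1<∣a∣ k k<n)

  B₂≈1 : B 2 ≈ 1#
  B₂≈1 = trans (+-congʳ (zeroˡ _)) (+-identityˡ 1#)

  ∣B∣-increasing : ∀ k → k ≤ n → ∣ B (suc k) ∣ₚ ℚ.< ∣ B (suc (suc k)) ∣ₚ
  ∣B∣<∣B*a∣ : ∀ k → k < n → ∣ B (suc (suc k)) ∣ₚ ℚ.< ∣ B (suc (suc k)) * ι (a (suc k)) ∣ₚ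
  ∣B*a∣≤∣B∣ : ∀ k → k < n → ∣ B (suc (suc k)) * ι (a (suc k)) ∣ₚ ℚ.≤ ∣ B (suc (suc (suc k))) ∣ₚ

  ∣B∣-increasing zero    _   =
    ≡.subst₂ ℚ._<_ (≡.sym ∣0∣) (≡.sym (≡.trans (abs-cong B₂≈1) ∣1∣)) (ℚP.positive⁻¹ 1ℚ)
  ∣B∣-increasing (suc k) k<n = ℚP.<-≤-trans (∣B∣<∣B*a∣ k k<n) (∣B*a∣≤∣B∣ k k<n)

  ∣B∣<∣B*a∣ k k<n = ≡.subst₂ ℚ._<_ (ℚP.*-identityʳ ∣ B (suc (suc k)) ∣ₚ) (≡.sym (abs-mul _ _))
    (ℚP.*-monoʳ-<-pos ∣ B (suc (suc k)) ∣ₚ {{ℚ.positive 0<∣B∣}} (1<∣a∣ k k<n))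
    where
    0<∣B∣ : 0ℚ ℚ.< ∣ B (suc (suc k)) ∣ₚ
    0<∣B∣ = ℚP.≤-<-trans (abs-nonneg _) (∣B∣-increasing k (ℕP.<⇒≤ k<n))

  ∣B*a∣≤∣B∣ k k<n = abs-+-dominant (ℚP.<-trans (∣B∣-increasing k (ℕP.<⇒≤ k<n)) (∣B∣<∣B*a∣ k k<n))

  1≤∣B∣*∣π^k∣ : ∀ k → k ≤ n → 1ℚ ℚ.≤ ∣ B (suc (suc k)) ∣ₚ ℚ.* ∣ π ^ k ∣ₚ
  1≤∣B∣*∣π^k∣ zero    _   = ℚP.≤-reflexive (≡.sym (≡.cong₂ ℚ._*_ (≡.trans (abs-cong B₂≈1) ∣1∣) ∣1∣))
  1≤∣B∣*∣π^k∣ (suc k) k<n = begin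
    1ℚ                                                  ≤⟨ 1≤x*y (1≤∣B∣*∣π^k∣ k (ℕP.<⇒≤ k<n)) (1≤∣a∣*∣π∣ k k<n) ⟩
    (∣ b₂ ∣ₚ ℚ.* ∣ π ^ k ∣ₚ) ℚ.* (∣ a₁ ∣ₚ ℚ.* ∣ π ∣ₚ)  ≡⟨ [xy][zw]≡[xz][wy] ∣ b₂ ∣ₚ ∣ π ^ k ∣ₚ ∣ a₁ ∣ₚ ∣ π ∣ₚ ⟩
    (∣ b₂ ∣ₚ ℚ.* ∣ a₁ ∣ₚ) ℚ.* (∣ π ∣ₚ ℚ.* ∣ π ^ k ∣ₚ)  ≡⟨ ≡.cong₂ ℚ._*_ (abs-mul b₂ a₁) (abs-mul π (π ^ k)) ⟨
    ∣ b₂ * a₁ ∣ₚ ℚ.* ∣ π ^ suc k ∣ₚ                     ≤⟨ abs-*-monoʳ-≤ (π ^ suc k) (∣B*a∣≤∣B∣ k k<n) ⟩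
    ∣ B (suc (suc (suc k))) ∣ₚ ℚ.* ∣ π ^ suc k ∣ₚ       ∎
    where
    open ℚP.≤-Reasoning
    b₂ a₁ : Carrier
    b₂ = B (suc (suc k))
    a₁ = ι (a (suc k))

  ∣sign∣≡1 : ∀ k → ∣ sign k ∣ₚ ≡ 1ℚ
  ∣sign∣≡1 zero    = ∣1∣
  ∣sign∣≡1 (suc k) = ≡.trans (∣-x∣ (sign k)) (∣sign∣≡1 k)

  Qₙ : Carrier
  Qₙ = ι (convergent a n)

  Qₙ*Bₙ≈Aₙ : Qₙ * B (suc (suc n)) ≈ A (suc (suc n))
  Qₙ*Bₙ≈Aₙ = begin
    Qₙ * B (suc (suc n))                 ≈⟨ *-comm Qₙ _ ⟩
    B (suc (suc n)) * Qₙ                 ≈⟨ *-congʳ (ι-B' (suc n)) ⟨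
    ι (B' a (suc n)) * Qₙ                ≈⟨ ι-* (B' a (suc n)) (convergent a n) ⟨
    ι (B' a (suc n) ℚ.* convergent a n)  ≈⟨ ι-cong (*-÷₀ (A' a (suc n)) B'≢0) ⟩
    ι (A' a (suc n))                     ≈⟨ ι-A' (suc n) ⟩
    A (suc (suc n))                      ∎
    where
    open SetoidReasoning setoid
    B'≢0 : B' a (suc n) ≢ 0ℚ
    B'≢0 B'≡0 = ℚP.<-irrefl (≡.sym ∣B∣≡0)
                  (ℚP.≤-<-trans (abs-nonneg (B (suc n))) (∣B∣-increasing n ℕP.≤-refl))
      where
      ∣B∣≡0 : ∣ B (suc (suc n)) ∣ₚ ≡ 0ℚ
      ∣B∣≡0 = ≡.trans (abs-cong (trans (sym (ι-B' (suc n))) (trans (ι-cong B'≡0) ι-0))) ∣0∣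

  γₙ≈aₙ+d : γ n ≈ ι (a n) + (γ n - ι (a n))
  γₙ≈aₙ+d = sym (trans (+-comm (ι (a n)) _) (//-rightDividesˡ (ι (a n)) (γ n)))

  error-identity : (α - Qₙ) * Bₓ n (γ n) * B (suc (suc n)) ≈ (γ n - ι (a n)) * sign n
  error-identity = +-cancelʳ (U * D) _ _ (begin
    e * D * V + U * D              ≈⟨ +-congˡ (*-congʳ Qₙ*Bₙ≈Aₙ) ⟨
    e * D * V + Qₙ * V * D         ≈⟨ solve 4 (λ e D V Q → e :* D :* V :+ Q :* V :* D := (e :+ Q) :* D :* V)
                                              refl e D V Qₙ ⟩
    (e + Qₙ) * D * V               ≈⟨ *-congʳ (*-congʳ (//-rightDividesˡ Qₙ α)) ⟩
    α * D * V                      ≈⟨ *-congʳ (complete-quotient-formula γ γ₀≈α n step) ⟩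
    Aₓ n (γ n) * V                 ≈⟨ *-congʳ (+-congʳ (*-congˡ γₙ≈aₙ+d)) ⟩
    Aₓ n (x + d) * V               ≈⟨ cross n x d ⟩
    U * Bₓ n (x + d) + d * sign n  ≈⟨ +-congʳ (*-congˡ (+-congʳ (*-congˡ γₙ≈aₙ+d))) ⟨
    U * D + d * sign n             ≈⟨ +-comm (U * D) _ ⟩
    d * sign n + U * D             ∎)
    where
    open SetoidReasoning setoid
    x d e D U V : Carrier
    x = ι (a n)
    d = γ n - x
    e = α - Qₙ
    D = Bₓ n (γ n)
    U = A (suc (suc n))
    V = B (suc (suc n))

  ∣Bₙ∣≤∣Bₓ∣ : ∣ B (suc (suc n)) ∣ₚ ℚ.≤ ∣ Bₓ n (γ n) ∣ₚ
  ∣Bₙ∣≤∣Bₓ∣ = ≡.subst (∣ B (suc (suc n)) ∣ₚ ℚ.≤_) (≡.sym (abs-cong D≈V+B*d)) (abs-+-dominant (begin-strict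
    ∣ B (suc n) * d ∣ₚ         ≡⟨ abs-mul (B (suc n)) d ⟩
    ∣ B (suc n) ∣ₚ ℚ.* ∣ d ∣ₚ  ≤⟨ x*y≤x (abs-nonneg (B (suc n))) (ℚP.<⇒≤ (close n ℕP.≤-refl)) ⟩
    ∣ B (suc n) ∣ₚ             <⟨ ∣B∣-increasing n ℕP.≤-refl ⟩
    ∣ B (suc (suc n)) ∣ₚ       ∎))
    where
    open ℚP.≤-Reasoning
    x d : Carrier
    x = ι (a n)
    d = γ n - x
    D≈V+B*d : Bₓ n (γ n) ≈ B (suc (suc n)) + B (suc n) * d
    D≈V+B*d = trans (+-congʳ (*-congˡ γₙ≈aₙ+d)) (extend-+ 1# 0# n x d)

  convergent-error : ∣ α - Qₙ ∣ₚ ℚ.< ∣ π ^ n ∣ₚ ℚ.* ∣ π ^ n ∣ₚ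
  convergent-error = begin-strict
    X                                     ≡⟨ ℚP.*-identityʳ X ⟨
    X ℚ.* 1ℚ                              ≤⟨ abs-*-monoˡ-≤ e (1≤x*y 1≤YP 1≤YP) ⟩
    X ℚ.* ((Y ℚ.* P) ℚ.* (Y ℚ.* P))       ≡⟨ x[yz][yz]≡[xyy][zz] X Y P ⟩
    ((X ℚ.* Y) ℚ.* Y) ℚ.* (P ℚ.* P)       ≤⟨ ℚP.*-monoʳ-≤-nonNeg (P ℚ.* P) {{ℚ.nonNegative (ℚP.<⇒≤ 0<P²)}}
                                               (abs-*-monoʳ-≤ V (abs-*-monoˡ-≤ e ∣Bₙ∣≤∣Bₓ∣)) ⟩
    ((X ℚ.* ∣ D ∣ₚ) ℚ.* Y) ℚ.* (P ℚ.* P)  <⟨ ℚP.*-monoˡ-<-pos (P ℚ.* P) {{ℚ.positive 0<P²}} XDY<1 ⟩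
    1ℚ ℚ.* (P ℚ.* P)                      ≡⟨ ℚP.*-identityˡ (P ℚ.* P) ⟩
    P ℚ.* P                               ∎
    where
    open ℚP.≤-Reasoning
    e D V : Carrier
    e = α - Qₙ
    D = Bₓ n (γ n)
    V = B (suc (suc n))
    X Y P : ℚ
    X = ∣ e ∣ₚ
    Y = ∣ V ∣ₚ
    P = ∣ π ^ n ∣ₚ
    1≤YP : 1ℚ ℚ.≤ Y ℚ.* P
    1≤YP = 1≤∣B∣*∣π^k∣ n ℕP.≤-refl
    0<P² : 0ℚ ℚ.< P ℚ.* P
    0<P² = ℚP.positive⁻¹ _ {{ℚP.pos*pos⇒pos P {{ℚ.positive (0<∣π^k∣ n)}} P {{ℚ.positive (0<∣π^k∣ n)}}}}
    XDY<1 : (X ℚ.* ∣ D ∣ₚ) ℚ.* Y ℚ.< 1ℚ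
    XDY<1 = begin-strict
      (X ℚ.* ∣ D ∣ₚ) ℚ.* Y                ≡⟨ ≡.cong (ℚ._* Y) (abs-mul e D) ⟨
      ∣ e * D ∣ₚ ℚ.* Y                    ≡⟨ abs-mul (e * D) V ⟨
      ∣ e * D * V ∣ₚ                      ≡⟨ abs-cong error-identity ⟩
      ∣ (γ n - ι (a n)) * sign n ∣ₚ       ≡⟨ abs-mul (γ n - ι (a n)) (sign n) ⟩
      ∣ γ n - ι (a n) ∣ₚ ℚ.* ∣ sign n ∣ₚ  ≡⟨ ≡.cong (∣ γ n - ι (a n) ∣ₚ ℚ.*_) (∣sign∣≡1 n) ⟩
      ∣ γ n - ι (a n) ∣ₚ ℚ.* 1ℚ           ≡⟨ ℚP.*-identityʳ _ ⟩
      ∣ γ n - ι (a n) ∣ₚ                  <⟨ close n ℕP.≤-refl ⟩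
      1ℚ                                  ∎

proposition2p1 : ∀ {c ℓ : Level} (p : ℕ) (pr : Prime p) → 2 < p →
    (K : Qp p pr c ℓ) (n : ℕ) (α β : Qp.Carrier K)
    (aα aβ : ℕ → ℚ) (γα γβ : ℕ → Qp.Carrier K) →
    BCF K α n aα γα → BCF K β n aβ γβ →
    convergent aα n ≡ convergent aβ n →
    Qp.∣_∣ₚ K (Qp._-_ K α β) ℚ.< invp2n p pr n
proposition2p1 p pr _ K n α β aα aβ γα γβ bcfα bcfβ Qα≡Qβ =
  ≡.subst (∣ α - β ∣ₚ ℚ.<_) (≡.sym (invp2n≡∣π^n∣² n)) (abs-sub-< ∣α-Qₙ∣<π²ⁿ ∣Qₙ-β∣<π²ⁿ)
  where
  open Qp K
  open ValuedField K
  Qₙ : Carrier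
  Qₙ = ι (convergent aα n)
  ∣α-Qₙ∣<π²ⁿ : ∣ α - Qₙ ∣ₚ ℚ.< ∣ π ^ n ∣ₚ ℚ.* ∣ π ^ n ∣ₚ
  ∣α-Qₙ∣<π²ⁿ = Expansion.convergent-error K bcfα
  ∣Qₙ-β∣<π²ⁿ : ∣ Qₙ - β ∣ₚ ℚ.< ∣ π ^ n ∣ₚ ℚ.* ∣ π ^ n ∣ₚ
  ∣Qₙ-β∣<π²ⁿ = ≡.subst (ℚ._< ∣ π ^ n ∣ₚ ℚ.* ∣ π ^ n ∣ₚ)
    (≡.trans (∣x-y∣≡∣y-x∣ β _) (≡.cong (λ q → ∣ ι q - β ∣ₚ) (≡.sym Qα≡Qβ)))
    (Expansion.convergent-error K bcfβ)
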